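{- Let $n\geq2$, $p\geq1$, $m\in\mathbb{N}$, and let $G_1,\ldots,G_n$ be vertex-disjoint graphs such that $K_i=\{u_{i,1},\ldots,u_{i,p}\}$ is a clique in $G_i$ for each $i\in[n]$. Let $G$ be obtained from the disjoint union of $G_1,\ldots,G_n$ by identifying $u_{1,q},\ldots,u_{n,q}$ as a single vertex $u_q$ for each $q\in[p]$. For each $i\in[n]$ let $\mathcal{H}_i=(L_i,H_i)$ be an $m$-fold cover of $G_i$ conducive to $K_i$, labeled so that $L_i(x)=\{(x,j):j\in[m]\}$ for all $x\in V(G_i)$ and $\{(u_{i,q},j):q\in[p]\}$ is a clique in $H_i$ for each $j\in[m]$. For $2\leq i\leq n$ let $f_i$ be a permutation of $[m]$, let $F=(f_2,\ldots,f_n)$, let $\gamma_1$ be the identity map of $[m]^p$ and $\gamma_i((j_1,\ldots,j_p))=(f_i(j_1),\ldots,f_i(j_p))$ for $2\le i\le n$. For $\mathbf{j}=(j_1,\ldots,j_p)\in[m]^p$ let $P_{i,\mathbf{j}}=\{(u_{i,q},j_q):q\in[p]\}$, and let $$D=\sum_{\mathbf{j}\in[m]^p}N(P_{1,\mathbf{j}},\mathcal{H}_1)\prod_{i=2}^{n}N(P_{i,\gamma_i(\mathbf{j})},\mathcal{H}_i).$$ If $\mathcal{H}$ is the $F$-amalgamated $m$-fold cover of $G$ obtained from $\mathcal{H}_1,\ldots,\mathcal{H}_n$, then $P_{DP}(G,\mathcal{H})=D$; consequently $P_{DP}'(G,\{u_1,\ldots,u_p\},m)\leq D$.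
   Context: All graphs are finite and simple; $[m]=\{1,\ldots,m\}$. A cover of a graph $G$ is a pair $\mathcal{H}=(L,H)$ where $H$ is a graph and $L:V(G)\to\mathcal{P}(V(H))$ satisfies: (1) $\{L(u):u\in V(G)\}$ is a partition of $V(H)$ into $|V(G)|$ parts; (2) $H[L(u)]$ is complete for each $u$; (3) if $E_H(L(u),L(v))$ is nonempty then $u=v$ or $uv\in E(G)$; (4) if $uv\in E(G)$ then $E_H(L(u),L(v))$ is a (possibly empty) matching. $\mathcal{H}$ is $m$-fold if $|L(u)|=m$ for all $u$, and full if moreover $E_H(L(u),L(v))$ is a perfect matching for every $uv\in E(G)$. An $m$-fold cover has a canonical labeling if its vertices can be named so that $L(u)=\{(u,j):j\in[m]\}$ and $(u,j)(v,j)\in E(H)$ for all $j$ whenever $uv\in E(G)$. An $\mathcal{H}$-coloring of $G$ is an independent set of $H$ of size $|V(G)|$; $P_{DP}(G,\mathcal{H})$ is their number, and for $P\subseteq V(H)$, $N(P,\mathcal{H})$ is the number of $\mathcal{H}$-colorings containing $P$. For a clique $K$ of $G$, $\mathcal{H}$ is conducive to $K$ if $\mathcal{H}$ is full and the subcover $(L|_K,H[\bigcup_{u\in K}L(u)])$ of $G[K]$ admits a canonical labeling; $P_{DP}'(G,K,m)$ is the minimum of $P_{DP}(G,\mathcal{H})$ over all $m$-fold covers $\mathcal{H}$ of $G$ conducive to $K$. The $F$-amalgamated $m$-fold cover $\mathcal{H}=(L,H)$ of $G$ obtained from $\mathcal{H}_1,\ldots,\mathcal{H}_n$ (with the labelings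 above) is defined as follows, writing $f_1$ for the identity permutation: $L(x)=\{(x,j):j\in[m]\}$ for each $x\in V(G)$; each $L(x)$ is a clique in $H$; for $x,y\in V(G_i)\setminus K_i$, $(x,r)(y,s)\in E(H)$ iff $(x,r)(y,s)\in E(H_i)$; for $x\in V(G_i)\setminus K_i$, $q\in[p]$ and $j\in[m]$, $(x,r)(u_q,j)\in E(H)$ iff $(x,r)(u_{i,q},f_i(j))\in E(H_i)$; for each $j\in[m]$, $\{(u_q,j):q\in[p]\}$ is a clique in $H$; and $H$ has no other edges. -}

module Defs where

open import Data.Nat using (ℕ; zero; suc; _*_; _≤_)
open import Data.Bool using (Bool; true; false; not; if_then_else_; _∨_)
open import Data.Fin using (Fin; zero; suc)
import Data.Fin as F
open import Data.Fin.Permutation using (Permutation′; _⟨$⟩ʳ_)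
open import Data.List using (List; []; _∷_; [_]; map; _++_; length; filter; concatMap; allFin; cartesianProduct)
open import Data.Nat.ListAction using (sum; product)
open import Data.List.Relation.Unary.All using (All; all?)
open import Data.List.Membership.DecPropositional using () renaming (_∈?_ to mem?)
open import Data.Vec.Functional using () renaming (_∷_ to _∷ᶠ_)
open import Data.Product using (Σ; ∃; _×_; _,_)
open import Data.Product.Properties using () renaming (≡-dec to ×-≡-dec)
open import Data.Sum using (_⊎_; inj₁; inj₂)
open import Data.Sum.Properties using () renaming (≡-dec to ⊎-≡-dec)
open import Data.Empty using (⊥-elim)
open import Relation.Nullary using (¬_; yes; no; does; _×-dec_)
open import Relation.Binary.Definitions using (DecidableEquality)
open import Relation.Binary.PropositionalEquality using (_≡_; _≢_; refl)
import Data.Nat as N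

record Graph (V : Set) : Set where
  field
    adj        : V → V → Bool
    adj-sym    : ∀ x y → adj x y ≡ adj y x
    adj-irrefl : ∀ x → adj x x ≡ false

Adjacent : {V : Set} → Graph V → V → V → Set
Adjacent G x y = Graph.adj G x y ≡ true

IsClique : {V : Set} {p : ℕ} → Graph V → (Fin p → V) → Set
IsClique G k = ∀ q q′ → q ≢ q′ → Adjacent G (k q) (k q′)

-- m-fold covers with the labeling L(u) = {(u , j) : j ∈ [m]}.
-- V(H) = V × Fin m; the cover is given by the adjacency of H.

CoverAdj : Set → ℕ → Set
CoverAdj V m = V × Fin m → V × Fin m → Bool

record IsMFoldCover {V : Set} (G : Graph V) (m : ℕ) (E : CoverAdj V m) : Set where
  field
    E-sym        : ∀ a b → E a b ≡ E b a
    E-irrefl     : ∀ a → E a a ≡ false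
    fiber-clique : ∀ u j j′ → j ≢ j′ → E (u , j) (u , j′) ≡ true
    E-between    : ∀ u v j l → E (u , j) (v , l) ≡ true → u ≡ v ⊎ Adjacent G u v
    matchingʳ    : ∀ u v → Adjacent G u v → ∀ j l l′ →
                   E (u , j) (v , l) ≡ true → E (u , j) (v , l′) ≡ true → l ≡ l′
    matchingˡ    : ∀ u v → Adjacent G u v → ∀ j j′ l →
                   E (u , j) (v , l) ≡ true → E (u , j′) (v , l) ≡ true → j ≡ j′

record IsFullCover {V : Set} (G : Graph V) (m : ℕ) (E : CoverAdj V m) : Set where
  field
    isCover  : IsMFoldCover G m E
    perfectʳ : ∀ u v → Adjacent G u v → ∀ j → ∃ λ l → E (u , j) (v , l) ≡ true
    perfectˡ : ∀ u v → Adjacent G u v → ∀ l → ∃ λ j → E (u , j) (v , l) ≡ true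

-- the subcover on the clique K admits a canonical labeling: relabel
-- (k q , σ q j) as (k q , j) so that (k q , j)(k q′ , j) ∈ E(H) for q ≠ q′
CanonicallyLabelable : {V : Set} {p : ℕ} (m : ℕ) → (Fin p → V) → CoverAdj V m → Set
CanonicallyLabelable {p = p} m k E =
  Σ (Fin p → Permutation′ m) λ σ →
    ∀ q q′ → q ≢ q′ → ∀ j → E (k q , σ q ⟨$⟩ʳ j) (k q′ , σ q′ ⟨$⟩ʳ j) ≡ true

Conducive : {V : Set} {p : ℕ} → Graph V → (Fin p → V) → (m : ℕ) → CoverAdj V m → Set
Conducive G k m E = IsFullCover G m E × CanonicallyLabelable m k E

-- Counting H-colorings. V is finite, enumerated (without repetition) by vs.

-- all sublists of a list (= all subsets when the list has no repetition)
sublists : {A : Set} → List A → List (List A)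
sublists []       = [ [] ]
sublists (x ∷ xs) = map (x ∷_) (sublists xs) ++ sublists xs

enumH : {V : Set} → List V → (m : ℕ) → List (V × Fin m)
enumH vs m = cartesianProduct vs (allFin m)

IsIndependent : {A : Set} → (A → A → Bool) → List A → Set
IsIndependent E S = All (λ a → All (λ b → E a b ≡ false) S) S

IsHColoring : {V : Set} {m : ℕ} → List V → CoverAdj V m → List (V × Fin m) → Set
IsHColoring vs E S = IsIndependent E S × length S ≡ length vs

-- N(P, H): number of H-colorings containing P
N : {V : Set} {m : ℕ} → DecidableEquality V → List V → CoverAdj V m →
    List (V × Fin m) → ℕ
N {V} {m} dec vs E P =
  length (filter (λ S → ((all? (λ a → all? (λ b → Data.Bool._≟_ (E a b) false) S) S)
                          ×-dec (length S N.≟ length vs))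
                        ×-dec all? (λ a → mem? (×-≡-dec dec F._≟_) a S) P)
                 (sublists (enumH vs m)))
  where import Data.Bool

PDP : {V : Set} {m : ℕ} → DecidableEquality V → List V → CoverAdj V m → ℕ
PDP dec vs E = N dec vs E []

-- "P'_DP(G, K, m) ≤ d": some m-fold cover of G conducive to K has at most d colorings
-- (the minimum over all such covers is ≤ d).
PDP′≤ : {V : Set} {p : ℕ} → DecidableEquality V → List V → Graph V →
        (Fin p → V) → (m : ℕ) → ℕ → Set
PDP′≤ dec vs G k m d =
  Σ (CoverAdj _ m) λ E → Conducive G k m E × PDP dec vs E ≤ d

-- The graphs G_i: vertex set K_i ⊎ (rest), with u_{i,q} = inj₁ q.

Vᵢ : ℕ → ℕ → Set
Vᵢ p r = Fin p ⊎ Fin r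

decᵢ : (p r : ℕ) → DecidableEquality (Vᵢ p r)
decᵢ p r = ⊎-≡-dec F._≟_ F._≟_

enumᵢ : (p r : ℕ) → List (Vᵢ p r)
enumᵢ p r = map inj₁ (allFin p) ++ map inj₂ (allFin r)

-- The graph G: vertices u_q = inj₁ q and inj₂ (i , x) for x ∈ V(G_i) ∖ K_i.
Vam : (n p : ℕ) → (Fin n → ℕ) → Set
Vam n p r = Fin p ⊎ Σ (Fin n) (λ i → Fin (r i))

decam : (n p : ℕ) (r : Fin n → ℕ) → DecidableEquality (Vam n p r)
decam n p r = ⊎-≡-dec F._≟_ (×-≡-dec F._≟_ F._≟_)

enumam : (n p : ℕ) (r : Fin n → ℕ) → List (Vam n p r)
enumam n p r = map inj₁ (allFin p)
            ++ map inj₂ (concatMap (λ i → map (i ,_) (allFin (r i))) (allFin n))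

anyFin : (k : ℕ) → (Fin k → Bool) → Bool
anyFin zero    f = false
anyFin (suc k) f = f zero ∨ anyFin k (λ i → f (suc i))

private
  anyFin-cong : ∀ k (f g : Fin k → Bool) → (∀ i → f i ≡ g i) → anyFin k f ≡ anyFin k g
  anyFin-cong zero f g e = refl
  anyFin-cong (suc k) f g e with f zero | g zero | e zero
  ... | b | .b | refl with anyFin k (λ i → f (suc i)) | anyFin k (λ i → g (suc i))
                         | anyFin-cong k (λ i → f (suc i)) (λ i → g (suc i)) (λ i → e (suc i))
  ... | c | .c | refl = refl

  anyFin-false : ∀ k (f : Fin k → Bool) → (∀ i → f i ≡ false) → anyFin k f ≡ false
  anyFin-false zero f e = refl
  anyFin-false (suc k) f e with f zero | e zero
  ... | .false | refl = anyFin-false k (λ i → f (suc i)) (λ i → e (suc i))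

module _ (n p : ℕ) (r : Fin n → ℕ) (Gs : (i : Fin n) → Graph (Vᵢ p (r i))) where
  open Graph

  amAdj : Vam n p r → Vam n p r → Bool
  amAdj (inj₁ q) (inj₁ q′) = anyFin n (λ i → adj (Gs i) (inj₁ q) (inj₁ q′))
  amAdj (inj₁ q) (inj₂ (i , y)) = adj (Gs i) (inj₁ q) (inj₂ y)
  amAdj (inj₂ (i , x)) (inj₁ q) = adj (Gs i) (inj₂ x) (inj₁ q)
  amAdj (inj₂ (i , x)) (inj₂ (i′ , y)) with i F.≟ i′
  ... | yes refl = adj (Gs i) (inj₂ x) (inj₂ y)
  ... | no _     = false

  private
    amSym : ∀ a b → amAdj a b ≡ amAdj b a
    amSym (inj₁ q) (inj₁ q′) =
      anyFin-cong n _ _ (λ i → adj-sym (Gs i) (inj₁ q) (inj₁ q′))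
    amSym (inj₁ q) (inj₂ (i , y)) = adj-sym (Gs i) (inj₁ q) (inj₂ y)
    amSym (inj₂ (i , x)) (inj₁ q) = adj-sym (Gs i) (inj₂ x) (inj₁ q)
    amSym (inj₂ (i , x)) (inj₂ (i′ , y)) with i F.≟ i′ | i′ F.≟ i
    ... | yes refl | yes refl = adj-sym (Gs i) (inj₂ x) (inj₂ y)
    ... | yes refl | no ne    = ⊥-elim (ne refl)
    ... | no ne    | yes refl = ⊥-elim (ne refl)
    ... | no _     | no _     = refl

    amIrr : ∀ a → amAdj a a ≡ false
    amIrr (inj₁ q) = anyFin-false n _ (λ i → adj-irrefl (Gs i) (inj₁ q))
    amIrr (inj₂ (i , x)) with i F.≟ i
    ... | yes refl = adj-irrefl (Gs i) (inj₂ x)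
    ... | no _     = refl

  amalgGraph : Graph (Vam n p r)
  amalgGraph = record { adj = amAdj ; adj-sym = amSym ; adj-irrefl = amIrr }

-- f_1 = id, f_{i+1} = fs i
fperm : {n m : ℕ} → (Fin n → Permutation′ m) → Fin (suc n) → Fin m → Fin m
fperm fs zero    j = j
fperm fs (suc i) j = fs i ⟨$⟩ʳ j

amalgCover : (n′ p m : ℕ) (r : Fin (suc n′) → ℕ) →
             (Es : (i : Fin (suc n′)) → CoverAdj (Vᵢ p (r i)) m) →
             (Fin n′ → Permutation′ m) → CoverAdj (Vam (suc n′) p r) m
amalgCover n′ p m r Es fs (inj₁ q , j) (inj₁ q′ , j′) with q F.≟ q′
... | yes _ = not (does (j F.≟ j′))
... | no _  = does (j F.≟ j′)           -- {(u_q , j) : q ∈ [p]} is a clique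
amalgCover n′ p m r Es fs (inj₁ q , j) (inj₂ (i , y) , s) =
  Es i (inj₂ y , s) (inj₁ q , fperm fs i j)
amalgCover n′ p m r Es fs (inj₂ (i , x) , s) (inj₁ q , j) =
  Es i (inj₂ x , s) (inj₁ q , fperm fs i j)
amalgCover n′ p m r Es fs (inj₂ (i , x) , s) (inj₂ (i′ , y) , t) with i F.≟ i′
... | yes refl = Es i (inj₂ x , s) (inj₂ y , t)
... | no _     = false

-- all functions Fin k → A with values in the list xs ([m]^p as Fin p → Fin m)
allFuns : {A : Set} (k : ℕ) → List A → List (Fin k → A)
allFuns zero    xs = [ (λ ()) ]
allFuns (suc k) xs = concatMap (λ x → map (x ∷ᶠ_) (allFuns k xs)) xs

Pset : {p r m : ℕ} → (Fin p → Fin m) → List (Vᵢ p r × Fin m)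
Pset {p} js = map (λ q → (inj₁ q , js q)) (allFin p)

Dsum : (n′ p m : ℕ) (r : Fin (suc n′) → ℕ) →
       (Es : (i : Fin (suc n′)) → CoverAdj (Vᵢ p (r i)) m) →
       (Fin n′ → Permutation′ m) → ℕ
Dsum n′ p m r Es fs =
  sum (map (λ js →
         N (decᵢ p (r zero)) (enumᵢ p (r zero)) (Es zero) (Pset js)
         * product (map (λ i → N (decᵢ p (r (suc i))) (enumᵢ p (r (suc i))) (Es (suc i))
                                 (Pset (λ q → fperm fs (suc i) (js q))))
                        (allFin n′)))
       (allFuns p (allFin m)))

-- The fibres L(x) are cliques of H, so an H-colouring of G picks exactly one colour per
-- vertex. Split such a colouring into its restriction to the clique, a tuple j ∈ [m]^p, and
-- its restrictions to the blocks V(G_i) ∖ K_i. H has no edges between different blocks, so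
-- for fixed j the number of completions is the product over i of the numbers of completions
-- inside each block. Block i together with the clique is a copy of H_i in which the colour
-- (u_q , j) corresponds to (u_{i,q} , f_i(j)); hence the i-th factor is N(P_{i,γ_i(j)}, H_i),
-- and summing over j gives D. The amalgamated cover is full because every H_i is, and it is
-- canonically labelled on the clique because f_1 is the identity, so it witnesses the bound
-- on P′_DP.
module Submission where

open import Defs
open import Data.Nat using (ℕ; zero; suc; _+_; _*_; _≤_; _<_; _≡ᵇ_; s≤s)
open import Data.Nat.Properties
  using (+-commutativeSemigroup; *-commutativeSemigroup; +-identityʳ; *-zeroʳ; *-identityʳ; *-assoc;
         *-distribˡ-+; *-distribʳ-+; ≤-refl; ≤-reflexive; m<n⇒m<1+n)
open import Data.Nat.ListAction using (sum; product)
open import Data.Nat.ListAction.Properties using (sum-++)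
open import Data.Bool using (Bool; true; false; not; _∧_; _∨_)
import Data.Bool as Bool
open import Data.Bool.Properties
  using (∧-assoc; ∧-identityʳ; ∧-zeroʳ; ∧-conicalˡ; ∧-conicalʳ; ∧-idempotentCommutativeMonoid)
open import Data.Fin using (Fin; zero; suc)
import Data.Fin as F
open import Data.Fin.Properties using (suc-injective)
import Data.Fin.Permutation as Perm
open import Data.Fin.Permutation using (Permutation′; _⟨$⟩ʳ_; _⟨$⟩ˡ_; inverseˡ; inverseʳ)
open import Data.List using (List; []; _∷_; [_]; map; _++_; length; filter; concatMap; allFin)
open import Data.Bool.ListAction using (and; all)
open import Data.List.Properties using (map-++; map-cong; map-∘; map-tabulate; ++-identityʳ)
open import Data.List.Relation.Unary.All as All using (All; all?)
open import Data.List.Relation.Unary.Any using (here; there)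
open import Data.List.Membership.Propositional using (_∈_; find)
open import Data.List.Membership.Propositional.Properties
  using (∈-map⁻; ∈-map⁺; ∈-++⁺ˡ; ∈-++⁻; ∈-allFin; ∈-concatMap⁻)
open import Data.List.Relation.Unary.Unique.Propositional using (Unique)
open import Data.List.Relation.Unary.AllPairs using ([]; _∷_)
open import Data.List.Relation.Unary.Unique.Propositional.Properties using (allFin⁺; map⁺)
open import Data.Vec.Functional using () renaming (_∷_ to _∷ᶠ_)
open import Data.Product using (∃; _×_; _,_; proj₁; proj₂)
open import Data.Sum using (_⊎_; inj₁; inj₂)
open import Data.Empty using (⊥-elim)
open import Function using (_∘_; id)
open import Relation.Nullary using (¬_; Dec; does; yes; no)
open import Relation.Nullary.Decidable using (dec-true; dec-false)
open import Relation.Binary.Definitions using (DecidableEquality)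
open import Data.Product.Properties using () renaming (≡-dec to ×-≡-dec)
open import Relation.Binary.PropositionalEquality
  using (_≡_; _≢_; _≗_; refl; sym; trans; cong; cong₂; subst; module ≡-Reasoning)
open import Algebra.Properties.CommutativeSemigroup +-commutativeSemigroup
  using () renaming (x∙yz≈y∙xz to m+[n+o]≡n+[m+o])
open import Algebra.Properties.CommutativeSemigroup *-commutativeSemigroup
  using () renaming (xy∙z≈xz∙y to m*n*o≡m*o*n)
open import Algebra.Solver.IdempotentCommutativeMonoid ∧-idempotentCommutativeMonoid
  using (solve; _⊜_; _⊕_) renaming (id to ⊤)

∑ : {A : Set} → (A → ℕ) → List A → ℕ
∑ h xs = sum (map h xs)

𝟙 : Bool → ℕ
𝟙 true  = 1
𝟙 false = 0

count : {A : Set} → (A → Bool) → List A → ℕ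
count f = ∑ (λ x → 𝟙 (f x))

𝟙-∧ : ∀ a b → 𝟙 (a ∧ b) ≡ 𝟙 a * 𝟙 b
𝟙-∧ true  b = sym (+-identityʳ (𝟙 b))
𝟙-∧ false b = refl

module _ {A : Set} where

  ∑-++ : ∀ (h : A → ℕ) xs ys → ∑ h (xs ++ ys) ≡ ∑ h xs + ∑ h ys
  ∑-++ h xs ys = trans (cong sum (map-++ h xs ys)) (sum-++ (map h xs) (map h ys))

  ∑-cong : ∀ {h h′ : A → ℕ} → h ≗ h′ → ∑ h ≗ ∑ h′
  ∑-cong h≗h′ xs = cong sum (map-cong h≗h′ xs)

  ∑-zero : ∀ {h : A → ℕ} → (∀ x → h x ≡ 0) → ∀ xs → ∑ h xs ≡ 0
  ∑-zero h≡0 []       = refl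
  ∑-zero h≡0 (x ∷ xs) = cong₂ _+_ (h≡0 x) (∑-zero h≡0 xs)

  ∑-*ˡ : ∀ c (h : A → ℕ) xs → ∑ (λ x → c * h x) xs ≡ c * ∑ h xs
  ∑-*ˡ c h []       = sym (*-zeroʳ c)
  ∑-*ˡ c h (x ∷ xs) = trans (cong (c * h x +_) (∑-*ˡ c h xs)) (sym (*-distribˡ-+ c (h x) _))

  ∑-*ʳ : ∀ c (h : A → ℕ) xs → ∑ (λ x → h x * c) xs ≡ ∑ h xs * c
  ∑-*ʳ c h []       = refl
  ∑-*ʳ c h (x ∷ xs) = trans (cong (h x * c +_) (∑-*ʳ c h xs)) (sym (*-distribʳ-+ c (h x) _))

  count-false : ∀ {f : A → Bool} → (∀ x → f x ≡ false) → ∀ xs → count f xs ≡ 0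
  count-false f≡false = ∑-zero (λ x → cong 𝟙 (f≡false x))

  count-cong : ∀ {f g : A → Bool} → f ≗ g → count f ≗ count g
  count-cong f≗g = ∑-cong (cong 𝟙 ∘ f≗g)

  length-filter≡count : ∀ {P : A → Set} (P? : ∀ x → Dec (P x)) xs →
                        length (filter P? xs) ≡ count (does ∘ P?) xs
  length-filter≡count P? []       = refl
  length-filter≡count P? (x ∷ xs) with does (P? x)
  ... | true  = cong suc (length-filter≡count P? xs)
  ... | false = length-filter≡count P? xs

module _ {A B : Set} where

  ∑-map : ∀ (h : B → ℕ) (g : A → B) xs → ∑ h (map g xs) ≡ ∑ (h ∘ g) xs
  ∑-map h g xs = cong sum (sym (map-∘ xs))

  ∑-concatMap : ∀ (h : B → ℕ) (g : A → List B) xs →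
                ∑ h (concatMap g xs) ≡ ∑ (λ x → ∑ h (g x)) xs
  ∑-concatMap h g []       = refl
  ∑-concatMap h g (x ∷ xs) =
    trans (∑-++ h (g x) (concatMap g xs)) (cong (∑ h (g x) +_) (∑-concatMap h g xs))

map-allFin-suc : ∀ {A : Set} m (g : Fin (suc m) → A) →
                 map g (allFin (suc m)) ≡ g zero ∷ map (g ∘ suc) (allFin m)
map-allFin-suc m g = cong (g zero ∷_) (trans (map-tabulate suc g) (sym (map-tabulate id (g ∘ suc))))

∑-allFin-suc : ∀ m (g : Fin (suc m) → ℕ) → ∑ g (allFin (suc m)) ≡ g zero + ∑ (g ∘ suc) (allFin m)
∑-allFin-suc m g = cong sum (map-allFin-suc m g)

∑-allFin-single : ∀ m (g : Fin m → ℕ) y → (∀ x → x ≢ y → g x ≡ 0) → ∑ g (allFin m) ≡ g y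
∑-allFin-single (suc m) g zero    g≡0 = begin
  ∑ g (allFin (suc m))               ≡⟨ ∑-allFin-suc m g ⟩
  g zero + ∑ (g ∘ suc) (allFin m)    ≡⟨ cong (g zero +_) (∑-zero (λ x → g≡0 (suc x) λ ()) (allFin m)) ⟩
  g zero + 0                         ≡⟨ +-identityʳ (g zero) ⟩
  g zero                             ∎
  where open ≡-Reasoning
∑-allFin-single (suc m) g (suc y) g≡0 = begin
  ∑ g (allFin (suc m))               ≡⟨ ∑-allFin-suc m g ⟩
  g zero + ∑ (g ∘ suc) (allFin m)    ≡⟨ cong (_+ ∑ (g ∘ suc) (allFin m)) (g≡0 zero λ ()) ⟩
  ∑ (g ∘ suc) (allFin m)
    ≡⟨ ∑-allFin-single m (g ∘ suc) y (λ x x≢y → g≡0 (suc x) (x≢y ∘ suc-injective)) ⟩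
  g (suc y) ∎
  where open ≡-Reasoning

module _ {A : Set} where

  all-++ : ∀ (f : A → Bool) xs ys → all f (xs ++ ys) ≡ all f xs ∧ all f ys
  all-++ f []       ys = refl
  all-++ f (x ∷ xs) ys = trans (cong (f x ∧_) (all-++ f xs ys)) (sym (∧-assoc (f x) _ _))

  all-cong : ∀ {f g : A → Bool} → f ≗ g → all f ≗ all g
  all-cong f≗g xs = cong and (map-cong f≗g xs)

  all-∧ : ∀ (f g : A → Bool) xs → all (λ x → f x ∧ g x) xs ≡ all f xs ∧ all g xs
  all-∧ f g []       = refl
  all-∧ f g (x ∷ xs) = trans (cong ((f x ∧ g x) ∧_) (all-∧ f g xs))
    (solve 4 (λ a b c d → (a ⊕ b) ⊕ (c ⊕ d) ⊜ (a ⊕ c) ⊕ (b ⊕ d)) refl (f x) (g x) (all f xs) (all g xs))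

  all-true : ∀ (f : A → Bool) xs → (∀ x → x ∈ xs → f x ≡ true) → all f xs ≡ true
  all-true f []       f≡true = refl
  all-true f (x ∷ xs) f≡true =
    cong₂ _∧_ (f≡true x (here refl)) (all-true f xs (λ y y∈xs → f≡true y (there y∈xs)))

  does-all? : ∀ {P : A → Set} (P? : ∀ x → Dec (P x)) xs → does (all? P? xs) ≡ all (does ∘ P?) xs
  does-all? P? []       = refl
  does-all? P? (x ∷ xs) = cong (does (P? x) ∧_) (does-all? P? xs)

all-map : ∀ {A B : Set} (f : B → Bool) (g : A → B) xs → all f (map g xs) ≡ all (f ∘ g) xs
all-map f g xs = cong and (sym (map-∘ xs))

module Independence {X : Set} (E : X → X → Bool) where

  noEdges : List X → List X → Bool
  noEdges S T = all (λ a → all (λ b → not (E a b)) T) S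

  independent : List X → Bool
  independent S = noEdges S S

  noEdges-++ʳ : ∀ S T U → noEdges S (T ++ U) ≡ noEdges S T ∧ noEdges S U
  noEdges-++ʳ S T U = trans (all-cong (λ a → all-++ _ T U) S) (all-∧ _ _ S)

  noEdges-true : ∀ S T → (∀ {a b} → a ∈ S → b ∈ T → E a b ≡ false) → noEdges S T ≡ true
  noEdges-true S T noEdge =
    all-true _ S (λ a a∈S → all-true _ T (λ b b∈T → cong not (noEdge a∈S b∈T)))

  independent-++ : ∀ S T → independent (S ++ T) ≡
                   (independent S ∧ noEdges S T) ∧ (noEdges T S ∧ independent T)
  independent-++ S T = trans (all-++ _ S T) (cong₂ _∧_ (noEdges-++ʳ S S T) (noEdges-++ʳ T S T))

  independent-++⁻ˡ : ∀ S T → independent (S ++ T) ≡ true → independent S ≡ true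
  independent-++⁻ˡ S T ind = ∧-conicalˡ _ (noEdges S T)
    (∧-conicalˡ _ (noEdges T S ∧ independent T) (trans (sym (independent-++ S T)) ind))

  independent-++⁻ʳ : ∀ S T → independent (S ++ T) ≡ true → independent T ≡ true
  independent-++⁻ʳ S T ind = ∧-conicalʳ (noEdges T S) _
    (∧-conicalʳ (independent S ∧ noEdges S T) _ (trans (sym (independent-++ S T)) ind))

  independent-∷-∷⁻ : ∀ a b S → independent (a ∷ b ∷ S) ≡ true → E a b ≡ false
  independent-∷-∷⁻ a b S ind with E a a | E a b | ind
  ... | false | false | _  = refl
  ... | true  | _     | ()
  ... | false | true  | ()

  independent-++-split : ∀ S T U → noEdges T U ≡ true → noEdges U T ≡ true →
                         independent (S ++ T ++ U) ≡ independent (S ++ T) ∧ independent (S ++ U)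
  independent-++-split S T U T↛U U↛T = begin
    independent (S ++ T ++ U)
      ≡⟨ independent-++ S (T ++ U) ⟩
    (independent S ∧ noEdges S (T ++ U)) ∧ (noEdges (T ++ U) S ∧ independent (T ++ U))
      ≡⟨ cong₂ (λ x y → (independent S ∧ x) ∧ (y ∧ independent (T ++ U)))
               (noEdges-++ʳ S T U) (all-++ _ T U) ⟩
    (independent S ∧ (noEdges S T ∧ noEdges S U)) ∧ ((noEdges T S ∧ noEdges U S) ∧ independent (T ++ U))
      ≡⟨ cong (λ x → (independent S ∧ (noEdges S T ∧ noEdges S U)) ∧ ((noEdges T S ∧ noEdges U S) ∧ x))
              (trans (independent-++ T U)
                     (cong₂ (λ x y → (independent T ∧ x) ∧ (y ∧ independent U)) T↛U U↛T)) ⟩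
    (independent S ∧ (noEdges S T ∧ noEdges S U)) ∧
      ((noEdges T S ∧ noEdges U S) ∧ ((independent T ∧ true) ∧ (true ∧ independent U)))
      ≡⟨ solve 7 (λ s st su ts us t u →
                   (s ⊕ (st ⊕ su)) ⊕ ((ts ⊕ us) ⊕ ((t ⊕ ⊤) ⊕ (⊤ ⊕ u)))
                   ⊜ ((s ⊕ st) ⊕ (ts ⊕ t)) ⊕ ((s ⊕ su) ⊕ (us ⊕ u)))
               refl (independent S) (noEdges S T) (noEdges S U) (noEdges T S) (noEdges U S)
                    (independent T) (independent U) ⟩
    ((independent S ∧ noEdges S T) ∧ (noEdges T S ∧ independent T)) ∧
      ((independent S ∧ noEdges S U) ∧ (noEdges U S ∧ independent U))
      ≡⟨ sym (cong₂ _∧_ (independent-++ S T) (independent-++ S U)) ⟩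
    independent (S ++ T) ∧ independent (S ++ U) ∎
    where open ≡-Reasoning


independent-map : ∀ {X Y : Set} (E : X → X → Bool) (E′ : Y → Y → Bool) (φ : X → Y) →
                  (∀ a b → E′ (φ a) (φ b) ≡ E a b) →
                  ∀ S → Independence.independent E′ (map φ S) ≡ Independence.independent E S
independent-map E E′ φ preserves S = trans (all-map _ φ S)
  (all-cong (λ a → trans (all-map _ φ S) (all-cong (λ b → cong not (preserves a b)) S)) S)

module _ {A : Set} where

  ∑-sublists-∷ : ∀ (h : List A → ℕ) x xs →
                 ∑ h (sublists (x ∷ xs)) ≡ ∑ (λ S → h (x ∷ S)) (sublists xs) + ∑ h (sublists xs)
  ∑-sublists-∷ h x xs = trans (∑-++ h (map (x ∷_) (sublists xs)) (sublists xs))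
                              (cong (_+ ∑ h (sublists xs)) (∑-map h (x ∷_) (sublists xs)))

  ∑-sublists-++ : ∀ (h : List A → ℕ) xs ys →
                  ∑ h (sublists (xs ++ ys)) ≡ ∑ (λ S → ∑ (λ T → h (S ++ T)) (sublists ys)) (sublists xs)
  ∑-sublists-++ h []       ys = sym (+-identityʳ _)
  ∑-sublists-++ h (x ∷ xs) ys = begin
    ∑ h (sublists (x ∷ xs ++ ys))
      ≡⟨ ∑-sublists-∷ h x (xs ++ ys) ⟩
    ∑ (λ S → h (x ∷ S)) (sublists (xs ++ ys)) + ∑ h (sublists (xs ++ ys))
      ≡⟨ cong₂ _+_ (∑-sublists-++ (λ S → h (x ∷ S)) xs ys) (∑-sublists-++ h xs ys) ⟩
    ∑ (λ S → ∑ (λ T → h (x ∷ S ++ T)) (sublists ys)) (sublists xs)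
      + ∑ (λ S → ∑ (λ T → h (S ++ T)) (sublists ys)) (sublists xs)
      ≡⟨ sym (∑-sublists-∷ (λ S → ∑ (λ T → h (S ++ T)) (sublists ys)) x xs) ⟩
    ∑ (λ S → ∑ (λ T → h (S ++ T)) (sublists ys)) (sublists (x ∷ xs)) ∎
    where open ≡-Reasoning

  ∑-sublists-onlyEmpty : ∀ (h : List A → ℕ) xs → (∀ {x} → x ∈ xs → ∀ S → h (x ∷ S) ≡ 0) →
                         ∑ h (sublists xs) ≡ h []
  ∑-sublists-onlyEmpty h []       h≡0 = +-identityʳ (h [])
  ∑-sublists-onlyEmpty h (x ∷ xs) h≡0 = begin
    ∑ h (sublists (x ∷ xs))
      ≡⟨ ∑-sublists-∷ h x xs ⟩
    ∑ (λ S → h (x ∷ S)) (sublists xs) + ∑ h (sublists xs)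
      ≡⟨ cong₂ _+_ (∑-zero (h≡0 (here refl)) (sublists xs)) (∑-sublists-onlyEmpty h xs (h≡0 ∘ there)) ⟩
    h [] ∎
    where open ≡-Reasoning

  ∑-sublists-atMostOne : ∀ (h : List A → ℕ) xs → Unique xs →
    (∀ {x y} → x ∈ xs → y ∈ xs → x ≢ y → ∀ S → h (x ∷ y ∷ S) ≡ 0) →
    ∑ h (sublists xs) ≡ h [] + ∑ (λ x → h [ x ]) xs
  ∑-sublists-atMostOne h []       _              _   = refl
  ∑-sublists-atMostOne h (x ∷ xs) (x∉xs ∷ uniq) h≡0 = begin
    ∑ h (sublists (x ∷ xs))
      ≡⟨ ∑-sublists-∷ h x xs ⟩
    ∑ (λ S → h (x ∷ S)) (sublists xs) + ∑ h (sublists xs)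
      ≡⟨ cong₂ _+_ (∑-sublists-onlyEmpty (λ S → h (x ∷ S)) xs
                      (λ y∈xs → h≡0 (here refl) (there y∈xs) (All.lookup x∉xs y∈xs)))
                   (∑-sublists-atMostOne h xs uniq (λ x∈ y∈ → h≡0 (there x∈) (there y∈))) ⟩
    h [ x ] + (h [] + ∑ (λ x → h [ x ]) xs)
      ≡⟨ m+[n+o]≡n+[m+o] (h [ x ]) (h []) _ ⟩
    h [] + ∑ (λ x → h [ x ]) (x ∷ xs) ∎
    where open ≡-Reasoning

assignments : {V : Set} (m : ℕ) → List V → List (List (V × Fin m))
assignments m []       = [ [] ]
assignments m (v ∷ vs) = concatMap (λ j → map ((v , j) ∷_) (assignments m vs)) (allFin m)

∑-assignments-∷ : ∀ {V : Set} {m} (h : List (V × Fin m) → ℕ) v vs →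
  ∑ h (assignments m (v ∷ vs)) ≡ ∑ (λ j → ∑ (λ S → h ((v , j) ∷ S)) (assignments m vs)) (allFin m)
∑-assignments-∷ {m = m} h v vs = trans (∑-concatMap h _ (allFin m))
                                       (∑-cong (λ j → ∑-map h ((v , j) ∷_) (assignments m vs)) (allFin m))

module _ {V : Set} {m : ℕ} where

  ∑-assignments-cong : ∀ vs {h h′ : List (V × Fin m) → ℕ} →
                       (∀ S → map proj₁ S ≡ vs → h S ≡ h′ S) →
                       ∑ h (assignments m vs) ≡ ∑ h′ (assignments m vs)
  ∑-assignments-cong []       h≡h′ = cong (_+ 0) (h≡h′ [] refl)
  ∑-assignments-cong (v ∷ vs) {h} {h′} h≡h′ = begin
    ∑ h (assignments m (v ∷ vs))
      ≡⟨ ∑-assignments-∷ h v vs ⟩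
    ∑ (λ j → ∑ (λ S → h ((v , j) ∷ S)) (assignments m vs)) (allFin m)
      ≡⟨ ∑-cong (λ j → ∑-assignments-cong vs (λ S S↦vs → h≡h′ _ (cong (v ∷_) S↦vs))) (allFin m) ⟩
    ∑ (λ j → ∑ (λ S → h′ ((v , j) ∷ S)) (assignments m vs)) (allFin m)
      ≡⟨ sym (∑-assignments-∷ h′ v vs) ⟩
    ∑ h′ (assignments m (v ∷ vs)) ∎
    where open ≡-Reasoning

  ∑-assignments-++ : ∀ (h : List (V × Fin m) → ℕ) xs ys →
    ∑ h (assignments m (xs ++ ys)) ≡ ∑ (λ S → ∑ (λ T → h (S ++ T)) (assignments m ys)) (assignments m xs)
  ∑-assignments-++ h []       ys = sym (+-identityʳ _)
  ∑-assignments-++ h (x ∷ xs) ys = begin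
    ∑ h (assignments m (x ∷ xs ++ ys))
      ≡⟨ ∑-assignments-∷ h x (xs ++ ys) ⟩
    ∑ (λ j → ∑ (λ S → h ((x , j) ∷ S)) (assignments m (xs ++ ys))) (allFin m)
      ≡⟨ ∑-cong (λ j → ∑-assignments-++ (λ S → h ((x , j) ∷ S)) xs ys) (allFin m) ⟩
    ∑ (λ j → ∑ (λ S → ∑ (λ T → h ((x , j) ∷ S ++ T)) (assignments m ys)) (assignments m xs)) (allFin m)
      ≡⟨ sym (∑-assignments-∷ (λ S → ∑ (λ T → h (S ++ T)) (assignments m ys)) x xs) ⟩
    ∑ (λ S → ∑ (λ T → h (S ++ T)) (assignments m ys)) (assignments m (x ∷ xs)) ∎
    where open ≡-Reasoning

  ∑-assignments-map : ∀ {W : Set} (g : V → W) (ψ : V × Fin m → W × Fin m)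
                      (h : List (W × Fin m) → ℕ) vs →
    (∀ {v} → v ∈ vs → ∀ j → ψ (v , j) ≡ (g v , j)) →
    ∑ h (assignments m (map g vs)) ≡ ∑ (h ∘ map ψ) (assignments m vs)
  ∑-assignments-map g ψ h []       ψ≡g = refl
  ∑-assignments-map g ψ h (v ∷ vs) ψ≡g = begin
    ∑ h (assignments m (g v ∷ map g vs))
      ≡⟨ ∑-assignments-∷ h (g v) (map g vs) ⟩
    ∑ (λ j → ∑ (λ S → h ((g v , j) ∷ S)) (assignments m (map g vs))) (allFin m)
      ≡⟨ ∑-cong (λ j → ∑-assignments-map g ψ (λ S → h ((g v , j) ∷ S)) vs (ψ≡g ∘ there)) (allFin m) ⟩
    ∑ (λ j → ∑ (λ S → h ((g v , j) ∷ map ψ S)) (assignments m vs)) (allFin m)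
      ≡⟨ ∑-cong (λ j → ∑-cong (λ S → cong (λ x → h (x ∷ map ψ S)) (sym (ψ≡g (here refl) j)))
                              (assignments m vs)) (allFin m) ⟩
    ∑ (λ j → ∑ (λ S → h (ψ (v , j) ∷ map ψ S)) (assignments m vs)) (allFin m)
      ≡⟨ sym (∑-assignments-∷ (h ∘ map ψ) v vs) ⟩
    ∑ (h ∘ map ψ) (assignments m (v ∷ vs)) ∎
    where open ≡-Reasoning

∑-allFuns-suc : ∀ p m (h : (Fin (suc p) → Fin m) → ℕ) →
  ∑ h (allFuns (suc p) (allFin m)) ≡ ∑ (λ j → ∑ (λ c → h (j ∷ᶠ c)) (allFuns p (allFin m))) (allFin m)
∑-allFuns-suc p m h = trans (∑-concatMap h _ (allFin m))
                            (∑-cong (λ j → ∑-map h (j ∷ᶠ_) (allFuns p (allFin m))) (allFin m))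

∑-allFuns-single : ∀ p m (h : (Fin p → Fin m) → ℕ) c Y →
  (∀ c′ → c′ ≗ c → h c′ ≡ Y) → (∀ c′ → ¬ c′ ≗ c → h c′ ≡ 0) →
  ∑ h (allFuns p (allFin m)) ≡ Y
∑-allFuns-single zero    m h c Y h≡Y h≡0 = trans (+-identityʳ _) (h≡Y _ λ ())
∑-allFuns-single (suc p) m h c Y h≡Y h≡0 = begin
  ∑ h (allFuns (suc p) (allFin m))
    ≡⟨ ∑-allFuns-suc p m h ⟩
  ∑ (λ j → ∑ (λ c′ → h (j ∷ᶠ c′)) (allFuns p (allFin m))) (allFin m)
    ≡⟨ ∑-allFin-single m _ (c zero) (λ j j≢c₀ →
         ∑-zero (λ c′ → h≡0 (j ∷ᶠ c′) (λ j∷c′≗c → j≢c₀ (j∷c′≗c zero))) (allFuns p (allFin m))) ⟩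
  ∑ (λ c′ → h (c zero ∷ᶠ c′)) (allFuns p (allFin m))
    ≡⟨ ∑-allFuns-single p m (λ c′ → h (c zero ∷ᶠ c′)) (c ∘ suc) Y
         (λ c′ c′≗c → h≡Y _ λ { zero → refl ; (suc q) → c′≗c q })
         (λ c′ c′≉c → h≡0 _ λ c₀∷c′≗c → c′≉c (c₀∷c′≗c ∘ suc)) ⟩
  Y ∎
  where open ≡-Reasoning

graphOf : {V : Set} {p m : ℕ} → (Fin p → V) → (Fin p → Fin m) → List (V × Fin m)
graphOf {p = p} k c = map (λ q → k q , c q) (allFin p)

∑-assignments-tabulate : ∀ {V : Set} {m} p (k : Fin p → V) (h : List (V × Fin m) → ℕ) →
  ∑ h (assignments m (map k (allFin p))) ≡ ∑ (λ c → h (graphOf k c)) (allFuns p (allFin m))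
∑-assignments-tabulate         zero    k h = refl
∑-assignments-tabulate {m = m} (suc p) k h = begin
  ∑ h (assignments m (map k (allFin (suc p))))
    ≡⟨ cong (∑ h ∘ assignments m) (map-allFin-suc p k) ⟩
  ∑ h (assignments m (k zero ∷ map (k ∘ suc) (allFin p)))
    ≡⟨ ∑-assignments-∷ h (k zero) (map (k ∘ suc) (allFin p)) ⟩
  ∑ (λ j → ∑ (λ S → h ((k zero , j) ∷ S)) (assignments m (map (k ∘ suc) (allFin p)))) (allFin m)
    ≡⟨ ∑-cong (λ j → ∑-assignments-tabulate p (k ∘ suc) (λ S → h ((k zero , j) ∷ S))) (allFin m) ⟩
  ∑ (λ j → ∑ (λ c → h ((k zero , j) ∷ graphOf (k ∘ suc) c)) (allFuns p (allFin m))) (allFin m)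
    ≡⟨ ∑-cong (λ j → ∑-cong (λ c → cong h (sym (map-allFin-suc p (λ q → k q , (j ∷ᶠ c) q))))
                             (allFuns p (allFin m))) (allFin m) ⟩
  ∑ (λ j → ∑ (λ c → h (graphOf k (j ∷ᶠ c))) (allFuns p (allFin m))) (allFin m)
    ≡⟨ sym (∑-allFuns-suc p m (h ∘ graphOf k)) ⟩
  ∑ (λ c → h (graphOf k c)) (allFuns (suc p) (allFin m)) ∎
  where open ≡-Reasoning

≟-refl : ∀ {k} (j : Fin k) → does (j F.≟ j) ≡ true
≟-refl j = dec-true (j F.≟ j) refl

module _ {X : Set} (_≟_ : DecidableEquality X) where

  open import Data.List.Membership.DecPropositional _≟_ using (_∈?_)

  includes : List X → List X → Bool
  includes P S = does (all? (_∈? S) P)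

  includes-++⁺ : ∀ P T → includes P (P ++ T) ≡ true
  includes-++⁺ P T = dec-true (all? (_∈? P ++ T) P) (All.tabulate ∈-++⁺ˡ)

  includes-false : ∀ {P S} → ¬ All (_∈ S) P → includes P S ≡ false
  includes-false {P} {S} P⊈S = dec-false (all? (_∈? S) P) P⊈S

-- An independent set meets each fibre at most once, so one of size |vs| is an assignment.
module Colourings {V : Set} {m : ℕ} (E : CoverAdj V m)
                  (fibre-clique : ∀ u j j′ → j ≢ j′ → E (u , j) (u , j′) ≡ true) where

  open Independence E using (independent; independent-++⁻ʳ; independent-∷-∷⁻)

  private
    Colour : Set
    Colour = V × Fin m

    fibre : V → List Colour
    fibre v = map (v ,_) (allFin m)

    ForcesIndependence : (List Colour → Bool) → Set
    ForcesIndependence Q = ∀ S → Q S ≡ true → independent S ≡ true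

    ForcesIndependence-∷ : ∀ {Q} → ForcesIndependence Q → ∀ x → ForcesIndependence (λ S → Q (x ∷ S))
    ForcesIndependence-∷ Q⇒ind x S Q[x∷S] = independent-++⁻ʳ [ x ] S (Q⇒ind (x ∷ S) Q[x∷S])

    fibre-pair-false : ∀ {Q} → ForcesIndependence Q → ∀ {v x y} →
                       x ∈ fibre v → y ∈ fibre v → x ≢ y → ∀ S → Q (x ∷ y ∷ S) ≡ false
    fibre-pair-false {Q} Q⇒ind {v} x∈ y∈ x≢y S with ∈-map⁻ (v ,_) x∈ | ∈-map⁻ (v ,_) y∈
    ... | j , _ , refl | j′ , _ , refl with Q ((v , j) ∷ (v , j′) ∷ S) in Q≡true
    ...   | false = refl
    ...   | true with trans (sym (independent-∷-∷⁻ _ _ S (Q⇒ind _ Q≡true)))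
                            (fibre-clique v j j′ (x≢y ∘ cong (v ,_)))
    ...     | ()

    Sized : (List Colour → Bool) → ℕ → List Colour → Bool
    Sized Q k S = Q S ∧ (length S ≡ᵇ k)

  count-sublists-fibre : ∀ v vs Q → ForcesIndependence Q → ∀ k →
    count (Sized Q (suc k)) (sublists (enumH (v ∷ vs) m))
    ≡ count (Sized Q (suc k)) (sublists (enumH vs m))
      + ∑ (λ j → count (Sized (λ S → Q ((v , j) ∷ S)) k) (sublists (enumH vs m))) (allFin m)
  count-sublists-fibre v vs Q Q⇒ind k = begin
    count (Sized Q (suc k)) (sublists (fibre v ++ enumH vs m))
      ≡⟨ ∑-sublists-++ (𝟙 ∘ Sized Q (suc k)) (fibre v) (enumH vs m) ⟩
    ∑ withPrefix (sublists (fibre v))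
      ≡⟨ ∑-sublists-atMostOne withPrefix (fibre v) (map⁺ (cong proj₂) (allFin⁺ m))
           (λ x∈ y∈ x≢y S → count-false
              (λ T → cong (_∧ _) (fibre-pair-false Q⇒ind x∈ y∈ x≢y (S ++ T))) (sublists (enumH vs m))) ⟩
    withPrefix [] + ∑ (λ x → withPrefix [ x ]) (fibre v)
      ≡⟨ cong (withPrefix [] +_) (∑-map (λ x → withPrefix [ x ]) (v ,_) (allFin m)) ⟩
    count (Sized Q (suc k)) (sublists (enumH vs m))
      + ∑ (λ j → count (Sized (λ S → Q ((v , j) ∷ S)) k) (sublists (enumH vs m))) (allFin m) ∎
    where
    open ≡-Reasoning
    withPrefix : List Colour → ℕ
    withPrefix S = count (λ T → Sized Q (suc k) (S ++ T)) (sublists (enumH vs m))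

  count-sized-sublists-tooLong : ∀ vs Q → ForcesIndependence Q → ∀ k → length vs < k →
                                 count (Sized Q k) (sublists (enumH vs m)) ≡ 0
  count-sized-sublists-tooLong []       Q Q⇒ind (suc k) _         = cong (λ b → 𝟙 b + 0) (∧-zeroʳ (Q []))
  count-sized-sublists-tooLong (v ∷ vs) Q Q⇒ind (suc k) (s≤s |vs|<k) =
    trans (count-sublists-fibre v vs Q Q⇒ind k)
          (cong₂ _+_ (count-sized-sublists-tooLong vs Q Q⇒ind (suc k) (m<n⇒m<1+n |vs|<k))
                     (∑-zero (λ j → count-sized-sublists-tooLong vs _ (ForcesIndependence-∷ Q⇒ind (v , j))
                                                                 k |vs|<k)
                             (allFin m)))

  count-sized-sublists : ∀ vs Q → ForcesIndependence Q →
                         count (Sized Q (length vs)) (sublists (enumH vs m)) ≡ count Q (assignments m vs)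
  count-sized-sublists []       Q Q⇒ind = cong (λ b → 𝟙 b + 0) (∧-identityʳ (Q []))
  count-sized-sublists (v ∷ vs) Q Q⇒ind = begin
    count (Sized Q (suc (length vs))) (sublists (enumH (v ∷ vs) m))
      ≡⟨ count-sublists-fibre v vs Q Q⇒ind (length vs) ⟩
    count (Sized Q (suc (length vs))) (sublists (enumH vs m))
      + ∑ (λ j → count (Sized (λ S → Q ((v , j) ∷ S)) (length vs)) (sublists (enumH vs m))) (allFin m)
      ≡⟨ cong₂ _+_ (count-sized-sublists-tooLong vs Q Q⇒ind (suc (length vs)) ≤-refl)
                   (∑-cong (λ j → count-sized-sublists vs _ (ForcesIndependence-∷ Q⇒ind (v , j))) (allFin m)) ⟩
    ∑ (λ j → count (λ S → Q ((v , j) ∷ S)) (assignments m vs)) (allFin m)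
      ≡⟨ sym (∑-assignments-∷ (𝟙 ∘ Q) v vs) ⟩
    count Q (assignments m (v ∷ vs)) ∎
    where open ≡-Reasoning

  N≡count-assignments : ∀ (_≟_ : DecidableEquality V) vs P →
    N _≟_ vs E P ≡ count (λ S → independent S ∧ includes (×-≡-dec _≟_ F._≟_) P S) (assignments m vs)
  N≡count-assignments _≟_ vs P =
    trans (length-filter≡count _ (sublists (enumH vs m)))
          (trans (count-cong filterCondition (sublists (enumH vs m)))
                 (count-sized-sublists vs _ (λ S → ∧-conicalˡ _ _)))
    where
    does-≟false : ∀ b → does (b Bool.≟ false) ≡ not b
    does-≟false true  = refl
    does-≟false false = refl

    does-independent : ∀ S → does (all? (λ a → all? (λ b → E a b Bool.≟ false) S) S) ≡ independent S
    does-independent S = trans (does-all? _ S)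
      (all-cong (λ a → trans (does-all? _ S) (all-cong (λ b → does-≟false (E a b)) S)) S)

    P⊆ : List Colour → Bool
    P⊆ = includes (×-≡-dec _≟_ F._≟_) P

    filterCondition : ∀ S → _ ≡ Sized (λ S → independent S ∧ P⊆ S) (length vs) S
    filterCondition S = trans (cong (λ b → (b ∧ (length S ≡ᵇ length vs)) ∧ P⊆ S) (does-independent S))
      (solve 3 (λ a l i → (a ⊕ l) ⊕ i ⊜ (a ⊕ i) ⊕ l) refl (independent S) (length S ≡ᵇ length vs) (P⊆ S))

module CliqueExtensions {p r m : ℕ} (E : CoverAdj (Vᵢ p r) m)
                        (fibre-clique : ∀ u j j′ → j ≢ j′ → E (u , j) (u , j′) ≡ true) where

  open Colourings E fibre-clique using (N≡count-assignments)
  open Independence E using (independent)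

  outside : List (Vᵢ p r)
  outside = map inj₂ (allFin r)

  Pset-cong : ∀ {c c′ : Fin p → Fin m} → c ≗ c′ → Pset {r = r} c ≡ Pset {r = r} c′
  Pset-cong c≗c′ = map-cong (λ q → cong (inj₁ q ,_) (c≗c′ q)) (allFin p)

  Pset-included⁻ : ∀ (c c′ : Fin p → Fin m) T → map proj₁ T ≡ outside →
                   All (_∈ Pset c′ ++ T) (Pset c) → c ≗ c′
  Pset-included⁻ c c′ T T↦outside Pc⊆ q
    with ∈-++⁻ (Pset c′) (All.lookup Pc⊆ (∈-map⁺ (λ q → inj₁ q , c q) (∈-allFin q)))
  ... | inj₁ ∈Pc′ with ∈-map⁻ (λ q → inj₁ q , c′ q) ∈Pc′
  ...   | q′ , _ , eq with cong proj₁ eq | cong proj₂ eq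
  ...     | refl | cq≡c′q = cq≡c′q
  Pset-included⁻ c c′ T T↦outside Pc⊆ q
      | inj₂ ∈T with ∈-map⁻ inj₂ (subst (inj₁ q ∈_) T↦outside (∈-map⁺ proj₁ ∈T))
  ... | _ , _ , ()

  N-Pset≡count-extensions : ∀ c → N (decᵢ p r) (enumᵢ p r) E (Pset c)
                                  ≡ count (λ T → independent (Pset c ++ T)) (assignments m outside)
  N-Pset≡count-extensions c = begin
    N (decᵢ p r) (enumᵢ p r) E (Pset c)
      ≡⟨ N≡count-assignments (decᵢ p r) (enumᵢ p r) (Pset c) ⟩
    count colouringWithPc (assignments m (map inj₁ (allFin p) ++ outside))
      ≡⟨ ∑-assignments-++ (𝟙 ∘ colouringWithPc) (map inj₁ (allFin p)) outside ⟩
    ∑ (λ S → count (λ T → colouringWithPc (S ++ T)) (assignments m outside))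
      (assignments m (map inj₁ (allFin p)))
      ≡⟨ ∑-assignments-tabulate p inj₁ _ ⟩
    ∑ (λ c′ → count (λ T → colouringWithPc (Pset c′ ++ T)) (assignments m outside)) (allFuns p (allFin m))
      ≡⟨ ∑-allFuns-single p m _ c _ atC awayFromC ⟩
    count (λ T → independent (Pset c ++ T)) (assignments m outside) ∎
    where
    open ≡-Reasoning
    colouringWithPc : List (Vᵢ p r × Fin m) → Bool
    colouringWithPc S = independent S ∧ includes (×-≡-dec (decᵢ p r) F._≟_) (Pset c) S

    atC : ∀ c′ → c′ ≗ c → count (λ T → colouringWithPc (Pset c′ ++ T)) (assignments m outside)
                           ≡ count (λ T → independent (Pset c ++ T)) (assignments m outside)
    atC c′ c′≗c = count-cong (λ T →
      trans (cong (λ P → colouringWithPc (P ++ T)) (Pset-cong c′≗c))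
            (trans (cong (independent (Pset c ++ T) ∧_) (includes-++⁺ _ (Pset c) T))
                   (∧-identityʳ _)))
      (assignments m outside)

    awayFromC : ∀ c′ → ¬ c′ ≗ c →
                count (λ T → colouringWithPc (Pset c′ ++ T)) (assignments m outside) ≡ 0
    awayFromC c′ c′≉c = trans
      (∑-assignments-cong outside {h′ = λ _ → 0} (λ T T↦outside →
        trans (cong (λ b → 𝟙 (independent (Pset c′ ++ T) ∧ b))
                    (includes-false _ (λ Pc⊆ → c′≉c (sym ∘ Pset-included⁻ c c′ T T↦outside Pc⊆))))
              (cong 𝟙 (∧-zeroʳ _))))
      (∑-zero (λ _ → refl) (assignments m outside))

module _ {V : Set} (G : Graph V) {m : ℕ} {E : CoverAdj V m} (E-sym : ∀ a b → E a b ≡ E b a) where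

  matchingˡ-from-matchingʳ :
    (∀ u v → Adjacent G u v → ∀ j l l′ →
       E (u , j) (v , l) ≡ true → E (u , j) (v , l′) ≡ true → l ≡ l′) →
    ∀ u v → Adjacent G u v → ∀ j j′ l →
      E (u , j) (v , l) ≡ true → E (u , j′) (v , l) ≡ true → j ≡ j′
  matchingˡ-from-matchingʳ matchingʳ u v adj j j′ l edge edge′ =
    matchingʳ v u (trans (Graph.adj-sym G v u) adj) l j j′ (trans (E-sym _ _) edge) (trans (E-sym _ _) edge′)

  perfectˡ-from-perfectʳ :
    (∀ u v → Adjacent G u v → ∀ j → ∃ λ l → E (u , j) (v , l) ≡ true) →
    ∀ u v → Adjacent G u v → ∀ l → ∃ λ j → E (u , j) (v , l) ≡ true
  perfectˡ-from-perfectʳ perfectʳ u v adj l =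
    let j , edge = perfectʳ v u (trans (Graph.adj-sym G v u) adj) l in j , trans (E-sym _ _) edge

module Amalgamation (n′ p m : ℕ) (r : Fin (suc n′) → ℕ)
  (Gs : (i : Fin (suc n′)) → Graph (Vᵢ p (r i)))
  (K-clique : ∀ i → IsClique (Gs i) inj₁)
  (Es : (i : Fin (suc n′)) → CoverAdj (Vᵢ p (r i)) m)
  (full : ∀ i → IsFullCover (Gs i) m (Es i))
  (K-labelled : ∀ i j q q′ → q ≢ q′ → Es i (inj₁ q , j) (inj₁ q′ , j) ≡ true)
  (fs : Fin n′ → Permutation′ m) where

  n : ℕ
  n = suc n′

  G : Graph (Vam n p r)
  G = amalgGraph n p r Gs

  E : CoverAdj (Vam n p r) m
  E = amalgCover n′ p m r Es fs

  module Cover i = IsMFoldCover (IsFullCover.isCover (full i))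

  private
    permutation : Fin n → Permutation′ m
    permutation zero    = Perm.id
    permutation (suc i) = fs i

    fperm≡permutation : ∀ i j → fperm fs i j ≡ permutation i ⟨$⟩ʳ j
    fperm≡permutation zero    j = refl
    fperm≡permutation (suc i) j = refl

  fperm⁻¹ : Fin n → Fin m → Fin m
  fperm⁻¹ i j = permutation i ⟨$⟩ˡ j

  fperm-fperm⁻¹ : ∀ i j → fperm fs i (fperm⁻¹ i j) ≡ j
  fperm-fperm⁻¹ i j = trans (fperm≡permutation i _) (inverseʳ (permutation i))

  fperm⁻¹-fperm : ∀ i j → fperm⁻¹ i (fperm fs i j) ≡ j
  fperm⁻¹-fperm i j = trans (cong (fperm⁻¹ i) (fperm≡permutation i j)) (inverseˡ (permutation i))

  fperm-injective : ∀ i {j j′} → fperm fs i j ≡ fperm fs i j′ → j ≡ j′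
  fperm-injective i {j} {j′} eq =
    trans (sym (fperm⁻¹-fperm i j)) (trans (cong (fperm⁻¹ i) eq) (fperm⁻¹-fperm i j′))

  fperm⁻¹-injective : ∀ i {j j′} → fperm⁻¹ i j ≡ fperm⁻¹ i j′ → j ≡ j′
  fperm⁻¹-injective i {j} {j′} eq =
    trans (sym (fperm-fperm⁻¹ i j)) (trans (cong (fperm fs i) eq) (fperm-fperm⁻¹ i j′))

  vertexEmbed : ∀ i → Vᵢ p (r i) → Vam n p r
  vertexEmbed i (inj₁ q) = inj₁ q
  vertexEmbed i (inj₂ x) = inj₂ (i , x)

  embed : ∀ i → Vᵢ p (r i) × Fin m → Vam n p r × Fin m
  embed i (inj₁ q , j) = inj₁ q , fperm⁻¹ i j
  embed i (inj₂ x , s) = inj₂ (i , x) , s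

  K-unlabelled : ∀ i {j j′ q q′} → q ≢ q′ → j ≢ j′ → Es i (inj₁ q , j) (inj₁ q′ , j′) ≡ false
  K-unlabelled i {j} {j′} {q} {q′} q≢q′ j≢j′ with Es i (inj₁ q , j) (inj₁ q′ , j′) in edge
  ... | false = refl
  ... | true  = ⊥-elim (j≢j′ (Cover.matchingʳ i (inj₁ q) (inj₁ q′) (K-clique i q q′ q≢q′) j j j′
                                                (K-labelled i j q q′ q≢q′) edge))

  embed-preserves : ∀ i a b → E (embed i a) (embed i b) ≡ Es i a b
  embed-preserves i (inj₁ q , j) (inj₁ q′ , j′) with q F.≟ q′ | j F.≟ j′
  ... | yes refl | yes refl = trans (cong not (≟-refl (fperm⁻¹ i j))) (sym (Cover.E-irrefl i _))
  ... | yes refl | no j≢j′  = trans (cong not (dec-false (_ F.≟ _) (j≢j′ ∘ fperm⁻¹-injective i)))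
                                    (sym (Cover.fiber-clique i (inj₁ q) j j′ j≢j′))
  ... | no q≢q′  | yes refl = trans (≟-refl (fperm⁻¹ i j)) (sym (K-labelled i j q q′ q≢q′))
  ... | no q≢q′  | no j≢j′  = trans (dec-false (_ F.≟ _) (j≢j′ ∘ fperm⁻¹-injective i))
                                    (sym (K-unlabelled i q≢q′ j≢j′))
  embed-preserves i (inj₁ q , j) (inj₂ y , s) =
    trans (cong (λ j → Es i (inj₂ y , s) (inj₁ q , j)) (fperm-fperm⁻¹ i j)) (Cover.E-sym i _ _)
  embed-preserves i (inj₂ x , s) (inj₁ q , j) =
    cong (λ j → Es i (inj₂ x , s) (inj₁ q , j)) (fperm-fperm⁻¹ i j)
  embed-preserves i (inj₂ x , s) (inj₂ y , t) with i F.≟ i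
  ... | yes refl = refl
  ... | no i≢i   = ⊥-elim (i≢i refl)

  fibre-clique : ∀ u j j′ → j ≢ j′ → E (u , j) (u , j′) ≡ true
  fibre-clique (inj₁ q) j j′ j≢j′ with q F.≟ q
  ... | yes _   = cong not (dec-false (j F.≟ j′) j≢j′)
  ... | no q≢q  = ⊥-elim (q≢q refl)
  fibre-clique (inj₂ (i , x)) j j′ j≢j′ =
    trans (embed-preserves i (inj₂ x , j) (inj₂ x , j′)) (Cover.fiber-clique i (inj₂ x) j j′ j≢j′)

  open Independence E using (independent; noEdges; independent-++⁻ˡ; independent-++-split; noEdges-true)

  block : Fin n → List (Vam n p r)
  block i = map inj₂ (map (i ,_) (allFin (r i)))

  blocks : List (Fin n) → List (Vam n p r)
  blocks is = map inj₂ (concatMap (λ i → map (i ,_) (allFin (r i))) is)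

  #extensions : List (Vam n p r × Fin m) → List (Vam n p r) → ℕ
  #extensions S vs = count (λ T → independent (S ++ T)) (assignments m vs)

  ∈-block⁻ : ∀ {i} {T : List (Vam n p r × Fin m)} {a} → map proj₁ T ≡ block i → a ∈ T →
             ∃ λ x → proj₁ a ≡ inj₂ (i , x)
  ∈-block⁻ {i} T↦block a∈T with ∈-map⁻ inj₂ (subst (_ ∈_) T↦block (∈-map⁺ proj₁ a∈T))
  ... | _ , ∈blk , refl with ∈-map⁻ (i ,_) ∈blk
  ...   | x , _ , refl = x , refl

  ∈-blocks⁻ : ∀ {is} {T : List (Vam n p r × Fin m)} {a} → map proj₁ T ≡ blocks is → a ∈ T →
              ∃ λ i → i ∈ is × ∃ λ x → proj₁ a ≡ inj₂ (i , x)
  ∈-blocks⁻ T↦blocks a∈T with ∈-map⁻ inj₂ (subst (_ ∈_) T↦blocks (∈-map⁺ proj₁ a∈T))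
  ... | _ , ∈blks , refl with find (∈-concatMap⁻ _ ∈blks)
  ...   | i , i∈is , ∈blk with ∈-map⁻ (i ,_) ∈blk
  ...     | x , _ , refl = i , i∈is , x , refl

  E-betweenBlocks : ∀ {i i′ x y} a b → proj₁ a ≡ inj₂ (i , x) → proj₁ b ≡ inj₂ (i′ , y) → i ≢ i′ →
                    E a b ≡ false
  E-betweenBlocks {i} {i′} (_ , s) (_ , t) refl refl i≢i′ with i F.≟ i′
  ... | yes i≡i′ = ⊥-elim (i≢i′ i≡i′)
  ... | no _     = refl

  noEdges-blocks : ∀ {i is} {T U : List (Vam n p r × Fin m)} → All (i ≢_) is →
                   map proj₁ T ≡ block i → map proj₁ U ≡ blocks is →
                   noEdges T U ≡ true × noEdges U T ≡ true
  noEdges-blocks {i} {is} {T} {U} i∉is T↦block U↦blocks =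
    noEdges-true T U (λ a∈T b∈U → proj₁ (apart a∈T b∈U)) ,
    noEdges-true U T (λ b∈U a∈T → proj₂ (apart a∈T b∈U))
    where
    apart : ∀ {a b} → a ∈ T → b ∈ U → E a b ≡ false × E b a ≡ false
    apart {a} {b} a∈T b∈U with ∈-block⁻ T↦block a∈T | ∈-blocks⁻ U↦blocks b∈U
    ... | _ , a↦ | _ , i′∈is , _ , b↦ = E-betweenBlocks a b a↦ b↦ (All.lookup i∉is i′∈is) ,
                                          E-betweenBlocks b a b↦ a↦ (All.lookup i∉is i′∈is ∘ sym)

  #extensions-absorbs : ∀ S vs → #extensions S vs * 𝟙 (independent S) ≡ #extensions S vs
  #extensions-absorbs S vs with independent S in S-independence
  ... | true  = *-identityʳ _
  ... | false = trans (*-zeroʳ (#extensions S vs)) (sym (count-false dependent (assignments m vs)))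
    where
    dependent : ∀ T → independent (S ++ T) ≡ false
    dependent T with independent (S ++ T) in ST-independence
    ... | false = refl
    ... | true with trans (sym (independent-++⁻ˡ S T ST-independence)) S-independence
    ...   | ()

  #extensions-blocks : ∀ S is → Unique is →
    #extensions S (blocks is) ≡ product (map (λ i → #extensions S (block i)) is) * 𝟙 (independent S)
  #extensions-blocks S []       _              = cong (λ T → 𝟙 (independent T) + 0) (++-identityʳ S)
  #extensions-blocks S (i ∷ is) (i∉is ∷ uniq) = begin
    #extensions S (blocks (i ∷ is))
      ≡⟨ cong (#extensions S) (map-++ inj₂ (map (i ,_) (allFin (r i))) _) ⟩
    #extensions S (block i ++ blocks is)
      ≡⟨ ∑-assignments-++ (λ T → 𝟙 (independent (S ++ T))) (block i) (blocks is) ⟩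
    ∑ (λ T → ∑ (λ U → 𝟙 (independent (S ++ T ++ U))) (assignments m (blocks is))) (assignments m (block i))
      ≡⟨ ∑-assignments-cong (block i) (λ T T↦block →
           trans (∑-assignments-cong (blocks is) (λ U U↦blocks → independence-splits T↦block U↦blocks))
                 (∑-*ˡ (𝟙 (independent (S ++ T))) (λ U → 𝟙 (independent (S ++ U)))
                       (assignments m (blocks is)))) ⟩
    ∑ (λ T → 𝟙 (independent (S ++ T)) * #extensions S (blocks is)) (assignments m (block i))
      ≡⟨ ∑-*ʳ (#extensions S (blocks is)) (λ T → 𝟙 (independent (S ++ T))) (assignments m (block i)) ⟩
    #extensions S (block i) * #extensions S (blocks is)
      ≡⟨ cong (#extensions S (block i) *_) (#extensions-blocks S is uniq) ⟩
    #extensions S (block i) * (product (map (λ i → #extensions S (block i)) is) * 𝟙 (independent S))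
      ≡⟨ sym (*-assoc (#extensions S (block i)) _ _) ⟩
    product (map (λ i → #extensions S (block i)) (i ∷ is)) * 𝟙 (independent S) ∎
    where
    open ≡-Reasoning
    independence-splits : ∀ {T U} → map proj₁ T ≡ block i → map proj₁ U ≡ blocks is →
      𝟙 (independent (S ++ T ++ U)) ≡ 𝟙 (independent (S ++ T)) * 𝟙 (independent (S ++ U))
    independence-splits {T} {U} T↦block U↦blocks =
      let T↛U , U↛T = noEdges-blocks i∉is T↦block U↦blocks
      in trans (cong 𝟙 (independent-++-split S T U T↛U U↛T))
               (𝟙-∧ (independent (S ++ T)) (independent (S ++ U)))

  #extensions-allBlocks : ∀ S → #extensions S (blocks (allFin n))
    ≡ #extensions S (block zero) * product (map (λ i → #extensions S (block (suc i))) (allFin n′))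
  #extensions-allBlocks S = begin
    #extensions S (blocks (allFin n))
      ≡⟨ #extensions-blocks S (allFin n) (allFin⁺ n) ⟩
    product (map (λ i → #extensions S (block i)) (allFin n)) * 𝟙 (independent S)
      ≡⟨ cong (λ xs → product xs * 𝟙 (independent S))
              (map-allFin-suc n′ (λ i → #extensions S (block i))) ⟩
    (#extensions S (block zero) * others) * 𝟙 (independent S)
      ≡⟨ m*n*o≡m*o*n (#extensions S (block zero)) others (𝟙 (independent S)) ⟩
    (#extensions S (block zero) * 𝟙 (independent S)) * others
      ≡⟨ cong (_* others) (#extensions-absorbs S (block zero)) ⟩
    #extensions S (block zero) * others ∎
    where
    open ≡-Reasoning
    others : ℕ
    others = product (map (λ i → #extensions S (block (suc i))) (allFin n′))

  N-Pset≡#extensions : ∀ i c → N (decᵢ p (r i)) (enumᵢ p (r i)) (Es i) (Pset (λ q → fperm fs i (c q)))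
                              ≡ #extensions (graphOf inj₁ c) (block i)
  N-Pset≡#extensions i c = begin
    N (decᵢ p (r i)) (enumᵢ p (r i)) (Es i) (Pset c″)
      ≡⟨ N-Pset≡count-extensions c″ ⟩
    count (λ T → Independence.independent (Es i) (Pset c″ ++ T)) (assignments m outside)
      ≡⟨ count-cong (λ T → trans (sym (independent-map (Es i) E (embed i) (embed-preserves i) (Pset c″ ++ T)))
                                 (cong independent (trans (map-++ (embed i) (Pset c″) T)
                                                          (cong (_++ map (embed i) T) embed-Pset))))
                    (assignments m outside) ⟩
    count (λ T → independent (graphOf inj₁ c ++ map (embed i) T)) (assignments m outside)
      ≡⟨ sym (∑-assignments-map (vertexEmbed i) (embed i) _ outside embed-outside) ⟩
    #extensions (graphOf inj₁ c) (map (vertexEmbed i) outside)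
      ≡⟨ cong (#extensions (graphOf inj₁ c)) (trans (sym (map-∘ (allFin (r i)))) (map-∘ (allFin (r i)))) ⟩
    #extensions (graphOf inj₁ c) (block i) ∎
    where
    open ≡-Reasoning
    open CliqueExtensions (Es i) (Cover.fiber-clique i) using (outside; N-Pset≡count-extensions)
    c″ : Fin p → Fin m
    c″ q = fperm fs i (c q)

    embed-Pset : map (embed i) (Pset c″) ≡ graphOf inj₁ c
    embed-Pset = trans (sym (map-∘ (allFin p)))
                       (map-cong (λ q → cong (inj₁ q ,_) (fperm⁻¹-fperm i (c q))) (allFin p))

    embed-outside : ∀ {v} → v ∈ outside → ∀ j → embed i (v , j) ≡ (vertexEmbed i v , j)
    embed-outside v∈ j with ∈-map⁻ inj₂ v∈
    ... | _ , _ , refl = refl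

  PDP≡Dsum : PDP (decam n p r) (enumam n p r) E ≡ Dsum n′ p m r Es fs
  PDP≡Dsum = begin
    PDP (decam n p r) (enumam n p r) E
      ≡⟨ N≡count-assignments (decam n p r) (enumam n p r) [] ⟩
    count (λ S → independent S ∧ true) (assignments m (map inj₁ (allFin p) ++ blocks (allFin n)))
      ≡⟨ count-cong (λ S → ∧-identityʳ (independent S)) (assignments m (map inj₁ (allFin p) ++ blocks (allFin n))) ⟩
    count independent (assignments m (map inj₁ (allFin p) ++ blocks (allFin n)))
      ≡⟨ ∑-assignments-++ (𝟙 ∘ independent) (map inj₁ (allFin p)) (blocks (allFin n)) ⟩
    ∑ (λ S → #extensions S (blocks (allFin n))) (assignments m (map inj₁ (allFin p)))
      ≡⟨ ∑-assignments-tabulate p inj₁ _ ⟩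
    ∑ (λ c → #extensions (graphOf inj₁ c) (blocks (allFin n))) (allFuns p (allFin m))
      ≡⟨ ∑-cong (λ c → trans (#extensions-allBlocks (graphOf inj₁ c))
           (cong₂ _*_ (sym (N-Pset≡#extensions zero c))
                      (cong product (map-cong (λ i → sym (N-Pset≡#extensions (suc i) c)) (allFin n′)))))
           (allFuns p (allFin m)) ⟩
    Dsum n′ p m r Es fs ∎
    where
    open ≡-Reasoning
    open Colourings E fibre-clique using (N≡count-assignments)

  -- Since f_1 is the identity, H restricted to the clique is H_1 restricted to K_1.
  E-K : ∀ q q′ j l → E (inj₁ q , j) (inj₁ q′ , l) ≡ Es zero (inj₁ q , j) (inj₁ q′ , l)
  E-K q q′ j l = embed-preserves zero (inj₁ q , j) (inj₁ q′ , l)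

  nonadjacent-self : ∀ {A : Set} u → Adjacent G u u → A
  nonadjacent-self u adj with trans (sym adj) (Graph.adj-irrefl G u)
  ... | ()

  adjacent-K : ∀ {q q′} → Adjacent (Gs zero) (inj₁ q) (inj₁ q′) → Adjacent G (inj₁ q) (inj₁ q′)
  adjacent-K {q} {q′} adj₀ = cong (_∨ anyFin n′ (λ i → Graph.adj (Gs (suc i)) (inj₁ q) (inj₁ q′))) adj₀

  adjacent-K⁻ : ∀ {q q′} → Adjacent G (inj₁ q) (inj₁ q′) → Adjacent (Gs zero) (inj₁ q) (inj₁ q′)
  adjacent-K⁻ {q} {q′} adj with q F.≟ q′
  ... | yes refl = nonadjacent-self (inj₁ q) adj
  ... | no q≢q′  = K-clique zero q q′ q≢q′

  E-sym : ∀ a b → E a b ≡ E b a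
  E-sym (inj₁ q , j)       (inj₁ q′ , l)       =
    trans (E-K q q′ j l) (trans (Cover.E-sym zero _ _) (sym (E-K q′ q l j)))
  E-sym (inj₁ q , j)       (inj₂ (i , y) , s)  = refl
  E-sym (inj₂ (i , x) , s) (inj₁ q , j)        = refl
  E-sym (inj₂ (i , x) , s) (inj₂ (i′ , y) , t) with i F.≟ i′
  ... | yes refl = trans (Cover.E-sym i _ _) (sym (embed-preserves i (inj₂ y , t) (inj₂ x , s)))
  ... | no i≢i′  = sym (E-betweenBlocks _ _ refl refl (i≢i′ ∘ sym))

  E-irrefl : ∀ a → E a a ≡ false
  E-irrefl (inj₁ q , j)       = trans (E-K q q j j) (Cover.E-irrefl zero _)
  E-irrefl (inj₂ (i , x) , s) = trans (embed-preserves i (inj₂ x , s) (inj₂ x , s)) (Cover.E-irrefl i _)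

  E-between : ∀ u v j l → E (u , j) (v , l) ≡ true → u ≡ v ⊎ Adjacent G u v
  E-between (inj₁ q) (inj₁ q′) j l edge
    with Cover.E-between zero (inj₁ q) (inj₁ q′) j l (trans (sym (E-K q q′ j l)) edge)
  ... | inj₁ refl = inj₁ refl
  ... | inj₂ adj₀ = inj₂ (adjacent-K adj₀)
  E-between (inj₁ q) (inj₂ (i , y)) j l edge with Cover.E-between i (inj₂ y) (inj₁ q) l _ edge
  ... | inj₂ adj = inj₂ (trans (Graph.adj-sym (Gs i) _ _) adj)
  E-between (inj₂ (i , x)) (inj₁ q) j l edge with Cover.E-between i (inj₂ x) (inj₁ q) j _ edge
  ... | inj₂ adj = inj₂ adj
  E-between (inj₂ (i , x)) (inj₂ (i′ , y)) j l edge with i F.≟ i′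
  E-between (inj₂ (i , x)) (inj₂ (i′ , y)) j l () | no _
  ... | yes refl with Cover.E-between i (inj₂ x) (inj₂ y) j l edge
  ...   | inj₁ refl = inj₁ refl
  ...   | inj₂ adj  = inj₂ adj

  matchingʳ : ∀ u v → Adjacent G u v → ∀ j l l′ →
              E (u , j) (v , l) ≡ true → E (u , j) (v , l′) ≡ true → l ≡ l′
  matchingʳ (inj₁ q) (inj₁ q′) adj j l l′ edge edge′ =
    Cover.matchingʳ zero (inj₁ q) (inj₁ q′) (adjacent-K⁻ adj) j l l′
                    (trans (sym (E-K q q′ j l)) edge) (trans (sym (E-K q q′ j l′)) edge′)
  matchingʳ (inj₁ q) (inj₂ (i , y)) adj j l l′ edge edge′ =
    Cover.matchingˡ i (inj₂ y) (inj₁ q) (trans (Graph.adj-sym (Gs i) _ _) adj) l l′ (fperm fs i j) edge edge′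
  matchingʳ (inj₂ (i , x)) (inj₁ q) adj j l l′ edge edge′ =
    fperm-injective i (Cover.matchingʳ i (inj₂ x) (inj₁ q) adj j _ _ edge edge′)
  matchingʳ (inj₂ (i , x)) (inj₂ (i′ , y)) adj j l l′ edge edge′ with i F.≟ i′
  matchingʳ (inj₂ (i , x)) (inj₂ (i′ , y)) () j l l′ edge edge′ | no _
  ... | yes refl = Cover.matchingʳ i (inj₂ x) (inj₂ y) adj j l l′ edge edge′

  perfectʳ : ∀ u v → Adjacent G u v → ∀ j → ∃ λ l → E (u , j) (v , l) ≡ true
  perfectʳ (inj₁ q) (inj₁ q′) adj j =
    let l , edge = IsFullCover.perfectʳ (full zero) (inj₁ q) (inj₁ q′) (adjacent-K⁻ adj) j
    in l , trans (E-K q q′ j l) edge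
  perfectʳ (inj₁ q) (inj₂ (i , y)) adj j =
    IsFullCover.perfectˡ (full i) (inj₂ y) (inj₁ q) (trans (Graph.adj-sym (Gs i) _ _) adj) (fperm fs i j)
  perfectʳ (inj₂ (i , x)) (inj₁ q) adj s =
    let l , edge = IsFullCover.perfectʳ (full i) (inj₂ x) (inj₁ q) adj s
    in fperm⁻¹ i l , subst (λ l → Es i (inj₂ x , s) (inj₁ q , l) ≡ true) (sym (fperm-fperm⁻¹ i l)) edge
  perfectʳ (inj₂ (i , x)) (inj₂ (i′ , y)) adj j with i F.≟ i′
  perfectʳ (inj₂ (i , x)) (inj₂ (i′ , y)) () j | no _
  ... | yes refl = IsFullCover.perfectʳ (full i) (inj₂ x) (inj₂ y) adj j

  isFullCover : IsFullCover G m E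
  isFullCover = record
    { isCover  = record
      { E-sym        = E-sym
      ; E-irrefl     = E-irrefl
      ; fiber-clique = fibre-clique
      ; E-between    = E-between
      ; matchingʳ    = matchingʳ
      ; matchingˡ    = matchingˡ-from-matchingʳ G E-sym matchingʳ
      }
    ; perfectʳ = perfectʳ
    ; perfectˡ = perfectˡ-from-perfectʳ G E-sym perfectʳ
    }

  canonicallyLabelable : CanonicallyLabelable m inj₁ E
  canonicallyLabelable =
    (λ _ → Perm.id) , λ q q′ q≢q′ j → trans (E-K q q′ j j) (K-labelled zero j q q′ q≢q′)

lemma20 : (n′ p m : ℕ) → 1 ≤ n′ → 1 ≤ p →
    (r : Fin (suc n′) → ℕ) →
    (Gs : (i : Fin (suc n′)) → Graph (Vᵢ p (r i))) →
    (∀ i → IsClique (Gs i) inj₁) →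
    (Es : (i : Fin (suc n′)) → CoverAdj (Vᵢ p (r i)) m) →
    (∀ i → Conducive (Gs i) inj₁ m (Es i)) →
    (∀ i j q q′ → q ≢ q′ → Es i (inj₁ q , j) (inj₁ q′ , j) ≡ true) →
    (fs : Fin n′ → Permutation′ m) →
    (PDP (decam (suc n′) p r) (enumam (suc n′) p r) (amalgCover n′ p m r Es fs)
       ≡ Dsum n′ p m r Es fs)
    × PDP′≤ (decam (suc n′) p r) (enumam (suc n′) p r) (amalgGraph (suc n′) p r Gs)
            inj₁ m (Dsum n′ p m r Es fs)
lemma20 n′ p m _ _ r Gs K-clique Es conducive K-labelled fs =
  PDP≡Dsum , E , (isFullCover , canonicallyLabelable) , ≤-reflexive PDP≡Dsum
  where open Amalgamation n′ p m r Gs K-clique Es (proj₁ ∘ conducive) K-labelled fs
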